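{- Let $\lambda$ be any partition with distinct parts having length $b\le 3$. Then the rank-generating function $F_{\lambda}(q)$ is unimodal.
   Context: For a partition with distinct parts $\lambda=\langle \lambda_1,\dots,\lambda_b\rangle$ (so $\lambda_1>\lambda_2>\dots>\lambda_b\ge 1$), a partition $\mu$ is contained in the shifted Ferrers shape $\lambda$ if $\mu=\langle\mu_1,\dots,\mu_k\rangle$ has distinct parts, $k\le b$, and $\mu_i\le\lambda_i$ for all $i\le k$ (the empty partition is included). The rank-generating function is $F_{\lambda}(q)=\sum_{\mu} q^{|\mu|}$, the sum over all such $\mu$, where $|\mu|$ is the sum of the parts of $\mu$. A polynomial $\sum_i c_iq^i$ is unimodal if there is an index $m$ with $c_0\le c_1\le\dots\le c_m\ge c_{m+1}\ge\dots$. -}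

module Defs where

open import Data.Nat using (ℕ; zero; suc; _+_; _≤_; _<_; _>_; _≟_; _≤?_; _<?_)
open import Data.List using (List; []; _∷_; length; map; concatMap; upTo; filter; _++_)
open import Data.Nat.ListAction using (sum)
open import Data.Product using (_×_; _,_; ∃-syntax)
open import Data.Unit using (⊤; tt)
open import Data.Empty using (⊥)
open import Relation.Nullary using (Dec; yes; no; _×-dec_)
open import Relation.Unary using (Decidable)
open import Relation.Binary.PropositionalEquality using (_≡_)

-- A partition is represented as the list of its parts ⟨λ₁,…,λ_b⟩.

data StrictDec : List ℕ → Set where
  sd-[] : StrictDec []
  sd-[x] : ∀ {x} → StrictDec (x ∷ [])
  sd-∷ : ∀ {x y ys} → x > y → StrictDec (y ∷ ys) → StrictDec (x ∷ y ∷ ys)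

data AllPos : List ℕ → Set where
  ap-[] : AllPos []
  ap-∷ : ∀ {x xs} → 1 ≤ x → AllPos xs → AllPos (x ∷ xs)

DistinctPartition : List ℕ → Set
DistinctPartition xs = StrictDec xs × AllPos xs

data FitsUnder : List ℕ → List ℕ → Set where
  fu-[] : ∀ {ls} → FitsUnder [] ls
  fu-∷ : ∀ {m ms l ls} → m ≤ l → FitsUnder ms ls → FitsUnder (m ∷ ms) (l ∷ ls)

-- μ is contained in the shifted Ferrers shape λ
ContainedIn : List ℕ → List ℕ → Set
ContainedIn μ λ' = DistinctPartition μ × FitsUnder μ λ'

strictDec? : (xs : List ℕ) → Dec (StrictDec xs)
strictDec? [] = yes sd-[]
strictDec? (x ∷ []) = yes sd-[x]
strictDec? (x ∷ y ∷ ys) with y <? x | strictDec? (y ∷ ys)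
... | yes p | yes q = yes (sd-∷ p q)
... | no ¬p | _ = no λ { (sd-∷ p _) → ¬p p }
... | yes _ | no ¬q = no λ { (sd-∷ _ q) → ¬q q }

allPos? : (xs : List ℕ) → Dec (AllPos xs)
allPos? [] = yes ap-[]
allPos? (x ∷ xs) with 1 ≤? x | allPos? xs
... | yes p | yes q = yes (ap-∷ p q)
... | no ¬p | _ = no λ { (ap-∷ p _) → ¬p p }
... | yes _ | no ¬q = no λ { (ap-∷ _ q) → ¬q q }

fitsUnder? : (ms ls : List ℕ) → Dec (FitsUnder ms ls)
fitsUnder? [] ls = yes fu-[]
fitsUnder? (m ∷ ms) [] = no λ ()
fitsUnder? (m ∷ ms) (l ∷ ls) with m ≤? l | fitsUnder? ms ls
... | yes p | yes q = yes (fu-∷ p q)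
... | no ¬p | _ = no λ { (fu-∷ p _) → ¬p p }
... | yes _ | no ¬q = no λ { (fu-∷ _ q) → ¬q q }

containedIn? : (λ' : List ℕ) → Decidable (λ μ → ContainedIn μ λ')
containedIn? λ' μ = (strictDec? μ ×-dec allPos? μ) ×-dec fitsUnder? μ λ'

listsOfLength : ℕ → ℕ → List (List ℕ)
listsOfLength N zero = [] ∷ []
listsOfLength N (suc k) = concatMap (λ x → map (x ∷_) (listsOfLength N k)) (upTo (suc N))

listsUpTo : ℕ → ℕ → List (List ℕ)
listsUpTo N zero = listsOfLength N zero
listsUpTo N (suc b) = listsUpTo N b ++ listsOfLength N (suc b)

head0 : List ℕ → ℕ
head0 [] = 0
head0 (x ∷ _) = x

-- The finite list (without repetition) of all μ contained in the shifted shape λ.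
-- Every such μ has length ≤ length λ and parts ≤ λ₁, so it occurs exactly once among the candidates.
containedPartitions : List ℕ → List (List ℕ)
containedPartitions λ' = filter (containedIn? λ') (listsUpTo (head0 λ') (length λ'))

-- coefficient of q^n in F_λ(q): number of contained μ with |μ| = n
rankCoeff : List ℕ → ℕ → ℕ
rankCoeff λ' n = length (filter (λ μ → sum μ ≟ n) (containedPartitions λ'))

Unimodal : (ℕ → ℕ) → Set
Unimodal c = ∃[ m ] ((∀ i → suc i ≤ m → c i ≤ c (suc i)) × (∀ i → m ≤ i → c (suc i) ≤ c i))

module Submission where

-- Write λ = ⟨a, b, c⟩ with a > b > c ≥ 0 (c = 0 for two parts).  A contained μ is
-- ⟨x⟩ ++ t for a tail t ∈ {⟨⟩, ⟨y⟩, ⟨y, z⟩}; for a fixed tail of sum s and largest part y the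
-- sizes |μ| fill the interval [y + 1 + s, a + s] (for t = ⟨⟩ with μ = ⟨⟩: [0, a]).  Hence the
-- coefficient cₙ is a sum of interval indicators, and stepping from n to n + 1 gives the
-- balance law  c (n+1) + leaving n = c n + entering n,  where entering n counts the intervals
-- starting at n + 1 and leaving n those ending at n.  Both counts have a closed form as a
-- number of admissible top parts y, and estimates on them show that entering − leaving
-- changes sign at most once (and is ≤ 0 beyond a + b).  A general criterion then gives
-- unimodality.

open import Defs
open import Data.Bool using (Bool; true; false)
open import Data.Empty using (⊥; ⊥-elim)
open import Data.List using (List; []; _∷_; length; map; concatMap; upTo; filter; _++_; applyUpTo)
open import Data.Nat using (ℕ; zero; suc; _+_; _*_; _∸_; _≤_; _<_; _≟_; _≤?_; _<?_; z≤n; s≤s; s≤s⁻¹; _⊓_; ⌊_/2⌋; ⌈_/2⌉)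
open import Data.Nat.ListAction using (sum)
open import Data.Nat.Properties
open import Algebra.Properties.CommutativeSemigroup +-commutativeSemigroup using () renaming (interchange to +-interchange)
open import Data.Product using (_×_; _,_; proj₁; proj₂; Σ)
open import Data.Sum using (_⊎_; inj₁; inj₂; [_,_]′)
open import Level using (Level)
open import Relation.Nullary using (Dec; yes; no; does; _×-dec_; ¬_)
open import Relation.Binary.PropositionalEquality

private
  variable
    p q r : Level
    P : Set p
    Q : Set q
    R : Set r

boolToℕ : Bool → ℕ
boolToℕ true = 1
boolToℕ false = 0

𝟙 : Dec P → ℕ
𝟙 d = boolToℕ (does d)

𝟙-yes : (d : Dec P) → P → 𝟙 d ≡ 1
𝟙-yes (yes _) _ = refl
𝟙-yes (no ¬p) p = ⊥-elim (¬p p)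

𝟙-no : (d : Dec P) → ¬ P → 𝟙 d ≡ 0
𝟙-no (yes p) ¬p = ⊥-elim (¬p p)
𝟙-no (no _) _ = refl

𝟙≤1 : (d : Dec P) → 𝟙 d ≤ 1
𝟙≤1 (yes _) = ≤-refl
𝟙≤1 (no _) = z≤n

𝟙-mono : (d : Dec P) (e : Dec Q) → (P → Q) → 𝟙 d ≤ 𝟙 e
𝟙-mono (yes p) (yes q) f = ≤-refl
𝟙-mono (yes p) (no ¬q) f = ⊥-elim (¬q (f p))
𝟙-mono (no ¬p) e f = z≤n

𝟙-cong : (d : Dec P) (e : Dec Q) → (P → Q) → (Q → P) → 𝟙 d ≡ 𝟙 e
𝟙-cong d e f g = ≤-antisym (𝟙-mono d e f) (𝟙-mono e d g)

𝟙-× : (d : Dec P) (e : Dec Q) → 𝟙 (d ×-dec e) ≡ 𝟙 d * 𝟙 e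
𝟙-× (yes p) (yes q) = refl
𝟙-× (yes p) (no ¬q) = refl
𝟙-× (no ¬p) e = refl

𝟙-cover : (d : Dec P) (e : Dec Q) (f : Dec R) → (R → P ⊎ Q) → 𝟙 f ≤ 𝟙 d + 𝟙 e
𝟙-cover d e (no _) h = z≤n
𝟙-cover (yes p) e (yes r) h = s≤s z≤n
𝟙-cover (no ¬p) (yes q) (yes r) h = ≤-refl
𝟙-cover (no ¬p) (no ¬q) (yes r) h with h r
... | inj₁ p = ⊥-elim (¬p p)
... | inj₂ q = ⊥-elim (¬q q)

𝟙-disjoint-union : (d : Dec P) (e : Dec Q) (f : Dec R) →
  (R → P ⊎ Q) → (P → R) → (Q → R) → (P → Q → ⊥) → 𝟙 d + 𝟙 e ≡ 𝟙 f
𝟙-disjoint-union d e f cover inl inr disjoint with d | e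
... | yes p | yes q = ⊥-elim (disjoint p q)
... | yes p | no _  = sym (𝟙-yes f (inl p))
... | no _  | yes q = sym (𝟙-yes f (inr q))
... | no ¬p | no ¬q = sym (𝟙-no f λ r → [ ¬p , ¬q ]′ (cover r))

sumOver : ∀ {A : Set} → List A → (A → ℕ) → ℕ
sumOver [] f = 0
sumOver (x ∷ xs) f = f x + sumOver xs f

sumBelow : ℕ → (ℕ → ℕ) → ℕ
sumBelow zero f = 0
sumBelow (suc M) f = f 0 + sumBelow M (λ y → f (suc y))

-- ∑[ y < M ] e extends over + and *, but not over ≡ or ≤.
infix 5 sumBelow
syntax sumBelow M (λ y → e) = ∑[ y < M ] e

length-filter : ∀ {A : Set} {P : A → Set p} (P? : ∀ x → Dec (P x)) (xs : List A) →
                length (filter P? xs) ≡ sumOver xs (λ x → 𝟙 (P? x))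
length-filter P? [] = refl
length-filter P? (x ∷ xs) with P? x
... | yes _ = cong suc (length-filter P? xs)
... | no _ = length-filter P? xs

sumOver-filter : ∀ {A : Set} {P : A → Set p} (P? : ∀ x → Dec (P x)) (xs : List A) (f : A → ℕ) →
                 sumOver (filter P? xs) f ≡ sumOver xs (λ x → 𝟙 (P? x) * f x)
sumOver-filter P? [] f = refl
sumOver-filter P? (x ∷ xs) f with P? x
... | yes _ = cong₂ _+_ (sym (+-identityʳ (f x))) (sumOver-filter P? xs f)
... | no _ = sumOver-filter P? xs f

sumOver-++ : ∀ {A : Set} (xs ys : List A) (f : A → ℕ) → sumOver (xs ++ ys) f ≡ sumOver xs f + sumOver ys f
sumOver-++ [] ys f = refl
sumOver-++ (x ∷ xs) ys f = trans (cong (f x +_) (sumOver-++ xs ys f)) (sym (+-assoc (f x) _ _))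

sumOver-map : ∀ {A B : Set} (g : A → B) (xs : List A) (f : B → ℕ) → sumOver (map g xs) f ≡ sumOver xs (λ x → f (g x))
sumOver-map g [] f = refl
sumOver-map g (x ∷ xs) f = cong (f (g x) +_) (sumOver-map g xs f)

sumOver-concatMap : ∀ {A B : Set} (g : A → List B) (xs : List A) (f : B → ℕ) →
                    sumOver (concatMap g xs) f ≡ sumOver xs (λ x → sumOver (g x) f)
sumOver-concatMap g [] f = refl
sumOver-concatMap g (x ∷ xs) f =
  trans (sumOver-++ (g x) (concatMap g xs) f) (cong (sumOver (g x) f +_) (sumOver-concatMap g xs f))

sumOver-upTo : ∀ M (f : ℕ → ℕ) → sumOver (upTo M) f ≡ sumBelow M f
sumOver-upTo M f = go (λ y → y) M
  where
  go : (g : ℕ → ℕ) (M : ℕ) → sumOver (applyUpTo g M) f ≡ sumBelow M (λ y → f (g y))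
  go g zero = refl
  go g (suc M) = cong (f (g 0) +_) (go (λ y → g (suc y)) M)

sumBelow-cong : ∀ M {f g : ℕ → ℕ} → (∀ y → y < M → f y ≡ g y) → sumBelow M f ≡ sumBelow M g
sumBelow-cong zero h = refl
sumBelow-cong (suc M) h = cong₂ _+_ (h 0 (s≤s z≤n)) (sumBelow-cong M (λ y y<M → h (suc y) (s≤s y<M)))

sumBelow-mono : ∀ M {f g : ℕ → ℕ} → (∀ y → y < M → f y ≤ g y) → sumBelow M f ≤ sumBelow M g
sumBelow-mono zero h = z≤n
sumBelow-mono (suc M) h = +-mono-≤ (h 0 (s≤s z≤n)) (sumBelow-mono M (λ y y<M → h (suc y) (s≤s y<M)))

sumBelow-+ : ∀ M (f g : ℕ → ℕ) → sumBelow M (λ y → f y + g y) ≡ sumBelow M f + sumBelow M g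
sumBelow-+ zero f g = refl
sumBelow-+ (suc M) f g =
  trans (cong ((f 0 + g 0) +_) (sumBelow-+ M (λ y → f (suc y)) (λ y → g (suc y))))
        (+-interchange (f 0) (g 0) _ _)

sumBelow-*ˡ : ∀ M (k : ℕ) (f : ℕ → ℕ) → sumBelow M (λ y → k * f y) ≡ k * sumBelow M f
sumBelow-*ˡ zero k f = sym (*-zeroʳ k)
sumBelow-*ˡ (suc M) k f =
  trans (cong (k * f 0 +_) (sumBelow-*ˡ M k (λ y → f (suc y)))) (sym (*-distribˡ-+ k (f 0) _))

sumBelow-zero : ∀ M {f : ℕ → ℕ} → (∀ y → y < M → f y ≡ 0) → sumBelow M f ≡ 0
sumBelow-zero zero h = refl
sumBelow-zero (suc M) h = cong₂ _+_ (h 0 (s≤s z≤n)) (sumBelow-zero M (λ y y<M → h (suc y) (s≤s y<M)))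

sumBelow-swap : ∀ M N (f : ℕ → ℕ → ℕ) → (∑[ x < M ] ∑[ y < N ] f x y) ≡ (∑[ y < N ] ∑[ x < M ] f x y)
sumBelow-swap zero N f = sym (sumBelow-zero N (λ _ _ → refl))
sumBelow-swap (suc M) N f =
  trans (cong (sumBelow N (f 0) +_) (sumBelow-swap M N (λ x → f (suc x))))
        (sym (sumBelow-+ N (f 0) (λ y → sumBelow M (λ x → f (suc x) y))))

sumBelow-snoc : ∀ M (f : ℕ → ℕ) → sumBelow (suc M) f ≡ sumBelow M f + f M
sumBelow-snoc zero f = +-comm (f 0) 0
sumBelow-snoc (suc M) f = trans (cong (f 0 +_) (sumBelow-snoc M (λ y → f (suc y)))) (sym (+-assoc (f 0) _ _))

*-balance : ∀ k {x₁ x₂ x₃ x₄} → x₁ + x₂ ≡ x₃ + x₄ → k * x₁ + k * x₂ ≡ k * x₃ + k * x₄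
*-balance k {x₁} {x₂} {x₃} {x₄} e = trans (sym (*-distribˡ-+ k x₁ x₂)) (trans (cong (k *_) e) (*-distribˡ-+ k x₃ x₄))

+-balance : ∀ p₁ p₂ p₃ p₄ q₁ q₂ q₃ q₄ → p₁ + p₂ ≡ p₃ + p₄ → q₁ + q₂ ≡ q₃ + q₄ →
            (p₁ + q₁) + (p₂ + q₂) ≡ (p₃ + q₃) + (p₄ + q₄)
+-balance p₁ p₂ p₃ p₄ q₁ q₂ q₃ q₄ ep eq =
  trans (+-interchange p₁ q₁ p₂ q₂) (trans (cong₂ _+_ ep eq) (+-interchange p₃ p₄ q₃ q₄))

sumBelow-balance : ∀ M (f₁ f₂ f₃ f₄ : ℕ → ℕ) → (∀ y → y < M → f₁ y + f₂ y ≡ f₃ y + f₄ y) →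
                   sumBelow M f₁ + sumBelow M f₂ ≡ sumBelow M f₃ + sumBelow M f₄
sumBelow-balance M f₁ f₂ f₃ f₄ e =
  trans (sym (sumBelow-+ M f₁ f₂)) (trans (sumBelow-cong M e) (sumBelow-+ M f₃ f₄))

sumBelow-none : ∀ M {R : ℕ → Set} (R? : ∀ z → Dec (R z)) → (∀ z → ¬ R z) → (∑[ z < M ] 𝟙 (R? z)) ≡ 0
sumBelow-none M R? h = sumBelow-zero M (λ y _ → 𝟙-no (R? y) (h y))

sumBelow-unique : ∀ M {R : ℕ → Set} (R? : ∀ z → Dec (R z)) w → w < M → R w → (∀ z → R z → z ≡ w) →
                  (∑[ z < M ] 𝟙 (R? z)) ≡ 1
sumBelow-unique (suc M) R? zero _ rw unique =
  cong₂ _+_ (𝟙-yes (R? 0) rw) (sumBelow-none M (λ z → R? (suc z)) (λ z r → 1+n≢0 (unique (suc z) r)))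
sumBelow-unique (suc M) R? (suc w) (s≤s w<M) rw unique =
  cong₂ _+_ (𝟙-no (R? 0) (λ r → 1+n≢0 (sym (unique 0 r))))
            (sumBelow-unique M (λ z → R? (suc z)) w w<M rw (λ z r → suc-injective (unique (suc z) r)))

sumBelow-shift : ∀ M s n {P : ℕ → Set} (P? : ∀ z → Dec (P z)) → (∀ z → P z → z < M) →
                 (∑[ z < M ] 𝟙 (P? z ×-dec (z + s ≟ n))) ≡ 𝟙 ((s ≤? n) ×-dec P? (n ∸ s))
sumBelow-shift M s n {P} P? bounded = by-cases ((s ≤? n) ×-dec P? (n ∸ s))
  where
  R? : ∀ z → Dec (P z × z + s ≡ n)
  R? z = P? z ×-dec (z + s ≟ n)
  solution : ∀ {z} → P z × z + s ≡ n → z ≡ n ∸ s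
  solution {z} (_ , e) = trans (sym (m+n∸n≡m z s)) (cong (_∸ s) e)
  by-cases : (d : Dec (s ≤ n × P (n ∸ s))) → (∑[ z < M ] 𝟙 (R? z)) ≡ 𝟙 d
  by-cases d@(yes (s≤n , pw)) =
    trans (sumBelow-unique M R? (n ∸ s) (bounded _ pw) (pw , m∸n+n≡m s≤n) (λ z → solution))
          (sym (𝟙-yes d (s≤n , pw)))
  by-cases d@(no ¬sol) =
    trans (sumBelow-none M R? (λ z r@(pz , e) → ¬sol (subst (s ≤_) e (m≤n+m s z) , subst P (solution r) pz)))
          (sym (𝟙-no d ¬sol))

countBetween : ℕ → ℕ → ℕ → ℕ
countBetween M L U = ∑[ y < M ] 𝟙 ((L ≤? y) ×-dec (y ≤? U))

countBetween-formula : ∀ M L U → countBetween M L U ≡ (M ⊓ suc U) ∸ L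
countBetween-formula zero L U = sym (0∸n≡0 L)
countBetween-formula (suc M) L U =
  trans (sumBelow-snoc M _) (trans (cong (_+ 𝟙 ((L ≤? M) ×-dec (M ≤? U))) (countBetween-formula M L U)) (step (M ≤? U)))
  where
  step : Dec (M ≤ U) → (M ⊓ suc U) ∸ L + 𝟙 ((L ≤? M) ×-dec (M ≤? U)) ≡ (suc M ⊓ suc U) ∸ L
  step (yes M≤U) rewrite m≤n⇒m⊓n≡m (m≤n⇒m≤1+n M≤U) | m≤n⇒m⊓n≡m (s≤s M≤U) with L ≤? M
  ... | yes L≤M = trans (cong ((M ∸ L) +_) (𝟙-yes ((L ≤? M) ×-dec (M ≤? U)) (L≤M , M≤U)))
                        (trans (+-comm (M ∸ L) 1) (sym (+-∸-assoc 1 L≤M)))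
  ... | no L≰M = trans (cong ((M ∸ L) +_) (𝟙-no ((L ≤? M) ×-dec (M ≤? U)) (λ p → L≰M (proj₁ p))))
                       (trans (+-identityʳ _) (trans (m≤n⇒m∸n≡0 (<⇒≤ (≰⇒> L≰M))) (sym (m≤n⇒m∸n≡0 (≰⇒> L≰M)))))
  step (no M≰U) rewrite m≥n⇒m⊓n≡n (≰⇒> M≰U) | m≥n⇒m⊓n≡n (s≤s (<⇒≤ (≰⇒> M≰U))) =
    trans (cong ((suc U ∸ L) +_) (𝟙-no ((L ≤? M) ×-dec (M ≤? U)) (λ p → M≰U (proj₂ p)))) (+-identityʳ _)

countBetween≤ : ∀ M L U → countBetween M L U ≤ suc U ∸ L
countBetween≤ M L U = subst (_≤ suc U ∸ L) (sym (countBetween-formula M L U)) (∸-monoˡ-≤ L (m⊓n≤n M (suc U)))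

countBetween≡ : ∀ M L U → U < M → countBetween M L U ≡ suc U ∸ L
countBetween≡ M L U U<M = trans (countBetween-formula M L U) (cong (_∸ L) (m≥n⇒m⊓n≡n U<M))

∸≤⇒≤+ : ∀ {n s t} → s ≤ n → n ∸ s ≤ t → n ≤ t + s
∸≤⇒≤+ {s = s} {t} s≤n h = subst (_≤ t + s) (m∸n+n≡m s≤n) (+-monoˡ-≤ s h)

≤+⇒∸≤ : ∀ {n s t} → n ≤ t + s → n ∸ s ≤ t
≤+⇒∸≤ {n} {s} {t} h = m≤n+o⇒m∸n≤o n s (subst (n ≤_) (+-comm t s) h)

∸<⇒<+ : ∀ {n s y} → s ≤ n → n ∸ s < y → n < y + s
∸<⇒<+ {y = y} s≤n h = ∸≤⇒≤+ (m≤n⇒m≤1+n s≤n) (subst (_≤ y) (sym (+-∸-assoc 1 s≤n)) h)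

<+⇒∸< : ∀ {n s y} → s ≤ n → n < y + s → n ∸ s < y
<+⇒∸< {y = y} s≤n h = subst (_≤ y) (+-∸-assoc 1 s≤n) (≤+⇒∸≤ h)

⌊n/2⌋-double≤n : ∀ n → ⌊ n /2⌋ + ⌊ n /2⌋ ≤ n
⌊n/2⌋-double≤n n = ≤-trans (+-monoʳ-≤ ⌊ n /2⌋ (⌊n/2⌋≤⌈n/2⌉ n)) (≤-reflexive (⌊n/2⌋+⌈n/2⌉≡n n))

n≤1+⌊n/2⌋-double : ∀ n → n ≤ suc (⌊ n /2⌋ + ⌊ n /2⌋)
n≤1+⌊n/2⌋-double zero = z≤n
n≤1+⌊n/2⌋-double (suc zero) = s≤s z≤n
n≤1+⌊n/2⌋-double (suc (suc n)) =
  s≤s (subst (λ t → suc n ≤ suc t) (sym (+-suc ⌊ n /2⌋ ⌊ n /2⌋)) (s≤s (n≤1+⌊n/2⌋-double n)))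

n≤⌈n/2⌉-double : ∀ n → n ≤ ⌈ n /2⌉ + ⌈ n /2⌉
n≤⌈n/2⌉-double n = ≤-trans (≤-reflexive (sym (⌊n/2⌋+⌈n/2⌉≡n n))) (+-monoˡ-≤ ⌈ n /2⌉ (⌊n/2⌋≤⌈n/2⌉ n))

double≤⇒≤⌊/2⌋ : ∀ {y k} → y + y ≤ k → y ≤ ⌊ k /2⌋
double≤⇒≤⌊/2⌋ {y} h = subst (_≤ _) (sym (n≡⌊n+n/2⌋ y)) (⌊n/2⌋-mono h)

≤⌊/2⌋⇒double≤ : ∀ {y k} → y ≤ ⌊ k /2⌋ → y + y ≤ k
≤⌊/2⌋⇒double≤ {k = k} h = ≤-trans (+-mono-≤ h h) (⌊n/2⌋-double≤n k)

<double⇒⌊/2⌋< : ∀ {k y} → k < y + y → ⌊ k /2⌋ < y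
<double⇒⌊/2⌋< h = ≰⇒> (λ y≤ → <⇒≱ h (≤⌊/2⌋⇒double≤ y≤))

⌊/2⌋<⇒<double : ∀ {k y} → ⌊ k /2⌋ < y → k < y + y
⌊/2⌋<⇒<double h = ≰⇒> (λ yy≤ → <⇒≱ h (double≤⇒≤⌊/2⌋ yy≤))

≤double⇒⌈/2⌉≤ : ∀ {L y} → L ≤ y + y → ⌈ L /2⌉ ≤ y
≤double⇒⌈/2⌉≤ {y = y} h = subst (_ ≤_) (sym (n≡⌈n+n/2⌉ y)) (⌈n/2⌉-mono h)

double≤1+double⇒≤ : ∀ {x y} → x + x ≤ suc (y + y) → x ≤ y
double≤1+double⇒≤ {x} {y} h = subst (x ≤_) (sym (n≡⌈n+n/2⌉ y)) (double≤⇒≤⌊/2⌋ h)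

double-suc : ∀ h → suc h + suc h ≡ suc (suc (h + h))
double-suc h = cong suc (+-suc h h)

double-∸ : ∀ h g c → h + h ≤ c + (g + g) → (h ∸ g) + (h ∸ g) ≤ c
double-∸ h zero c hyp = subst (h + h ≤_) (+-identityʳ c) hyp
double-∸ zero (suc g) c hyp = z≤n
double-∸ (suc h) (suc g) c hyp = double-∸ h g c (s≤s⁻¹ (s≤s⁻¹ (subst₂ _≤_ (double-suc h) shift hyp)))
  where
  shift : c + (suc g + suc g) ≡ suc (suc (c + (g + g)))
  shift = trans (cong (c +_) (double-suc g)) (trans (+-suc c _) (cong suc (+-suc c _)))

-- A sequence c is unimodal as soon as it satisfies a balance law c (n+1) + V n = c n + U n
-- (c gains U n and loses V n at step n) in which U − V changes sign at most once, from ≥ 0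
-- to < 0, and U ≤ V eventually: c then rises up to the first k with U k < V k and falls after.
module _ (c U V : ℕ → ℕ) (balance : ∀ n → c (suc n) + V n ≡ c n + U n) where

  rises : ∀ n → V n ≤ U n → c n ≤ c (suc n)
  rises n h = +-cancelʳ-≤ (V n) (c n) (c (suc n)) (subst (c n + V n ≤_) (sym (balance n)) (+-monoʳ-≤ (c n) h))

  falls : ∀ n → U n ≤ V n → c (suc n) ≤ c n
  falls n h = +-cancelʳ-≤ (V n) (c (suc n)) (c n) (subst (_≤ c n + V n) (sym (balance n)) (+-monoʳ-≤ (c n) h))

  first-crossing : ∀ B → (∀ i → i < B → V i ≤ U i) ⊎ Σ ℕ (λ k → U k < V k × (∀ i → i < k → V i ≤ U i))
  first-crossing zero = inj₁ (λ i ())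
  first-crossing (suc B) with first-crossing B
  ... | inj₂ found = inj₂ found
  ... | inj₁ below with U B <? V B
  ...   | yes lt = inj₂ (B , lt , below)
  ...   | no ¬lt = inj₁ (λ i i≤B → [ below i , (λ { refl → ≮⇒≥ ¬lt }) ]′ (m<1+n⇒m<n∨m≡n i≤B))

  unimodal-by-balance : (∀ k k' → k ≤ k' → U k < V k → U k' ≤ V k') → (B : ℕ) → (∀ n → B ≤ n → U n ≤ V n) →
                        Unimodal c
  unimodal-by-balance single-crossing B eventually with first-crossing B
  ... | inj₁ below = B , (λ i i<B → rises i (below i i<B)) , (λ i B≤i → falls i (eventually i B≤i))
  ... | inj₂ (k , lt , before) = k , (λ i i<k → rises i (before i i<k)) , (λ i k≤i → falls i (single-crossing k i k≤i lt))

Unimodal-≗ : ∀ {f g : ℕ → ℕ} → (∀ n → f n ≡ g n) → Unimodal g → Unimodal f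
Unimodal-≗ {f} {g} f≗g (m , up , down) =
  m , (λ i i<m → subst₂ _≤_ (sym (f≗g i)) (sym (f≗g (suc i))) (up i i<m))
    , (λ i m≤i → subst₂ _≤_ (sym (f≗g (suc i))) (sym (f≗g i)) (down i m≤i))

inInterval : ℕ → ℕ → ℕ → ℕ
inInterval L H n = 𝟙 ((L ≤? n) ×-dec (n ≤? H))

≤?-suc : ∀ m n → does (suc m ≤? suc n) ≡ does (m ≤? n)
≤?-suc zero n = refl
≤?-suc (suc m) n = refl

inInterval-shift : ∀ L H n → inInterval (suc L) (suc H) (suc n) ≡ inInterval L H n
inInterval-shift L H n rewrite ≤?-suc L n | ≤?-suc n H = refl

inInterval-from-zero : ∀ H n → inInterval 0 H (suc n) + 𝟙 (H ≟ n) ≡ inInterval 0 H n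
inInterval-from-zero zero zero = refl
inInterval-from-zero zero (suc n) = refl
inInterval-from-zero (suc H) zero = refl
inInterval-from-zero (suc H) (suc n)
  rewrite ≤?-suc (suc n) H | ≤?-suc n H = inInterval-from-zero H n

inInterval-split-zero : ∀ H n → 𝟙 (0 ≟ n) + inInterval 1 H n ≡ inInterval 0 H n
inInterval-split-zero H zero = refl
inInterval-split-zero H (suc n) = refl

inInterval-step : ∀ L H n → L ≤ suc H → inInterval L H (suc n) + 𝟙 (H ≟ n) ≡ inInterval L H n + 𝟙 (L ≟ suc n)
inInterval-step zero H n _ = trans (inInterval-from-zero H n) (sym (+-identityʳ _))
inInterval-step (suc zero) zero zero _ = refl
inInterval-step (suc zero) (suc H) zero _ = refl
inInterval-step (suc (suc L)) (suc H) zero _ = refl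
inInterval-step (suc L) zero (suc n) (s≤s z≤n) = refl
inInterval-step (suc L) (suc H) (suc n) (s≤s L≤1+H)
  rewrite inInterval-shift L H (suc n) | inInterval-shift L H n = inInterval-step L H n L≤1+H

-- An interval indicator is unimodal: nothing enters after 0, and [H = n] leaves at n.
interval-unimodal : ∀ H → Unimodal (inInterval 0 H)
interval-unimodal H = unimodal-by-balance (inInterval 0 H) (λ _ → 0) (λ n → 𝟙 (H ≟ n))
  (λ n → trans (inInterval-from-zero H n) (sym (+-identityʳ _))) (λ _ _ _ _ → z≤n) 0 (λ _ _ → z≤n)

counted : List ℕ → ℕ → List ℕ → ℕ
counted λ' n μ = 𝟙 (containedIn? λ' μ) * 𝟙 (sum μ ≟ n)

rankCoeff-as-sum : ∀ λ' n → rankCoeff λ' n ≡ sumOver (listsUpTo (head0 λ') (length λ')) (counted λ' n)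
rankCoeff-as-sum λ' n =
  trans (length-filter (λ μ → sum μ ≟ n) (containedPartitions λ'))
        (sumOver-filter (containedIn? λ') (listsUpTo (head0 λ') (length λ')) (λ μ → 𝟙 (sum μ ≟ n)))

sumOver-listsOfLength : ∀ N k (f : List ℕ → ℕ) →
  sumOver (listsOfLength N (suc k)) f ≡ ∑[ x < suc N ] sumOver (listsOfLength N k) (λ μ → f (x ∷ μ))
sumOver-listsOfLength N k f =
  trans (sumOver-concatMap (λ x → map (x ∷_) (listsOfLength N k)) (upTo (suc N)) f)
  (trans (sumOver-upTo (suc N) (λ x → sumOver (map (x ∷_) (listsOfLength N k)) f))
         (sumBelow-cong (suc N) (λ x _ → sumOver-map (x ∷_) (listsOfLength N k) f)))

sumOver-lists₁ : ∀ N (f : List ℕ → ℕ) → sumOver (listsOfLength N 1) f ≡ ∑[ x < suc N ] f (x ∷ [])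
sumOver-lists₁ N f = trans (sumOver-listsOfLength N 0 f) (sumBelow-cong (suc N) (λ x _ → +-identityʳ (f (x ∷ []))))

sumOver-lists₂ : ∀ N (f : List ℕ → ℕ) → sumOver (listsOfLength N 2) f ≡ ∑[ x < suc N ] ∑[ y < suc N ] f (x ∷ y ∷ [])
sumOver-lists₂ N f = trans (sumOver-listsOfLength N 1 f) (sumBelow-cong (suc N) (λ x _ → sumOver-lists₁ N (λ μ → f (x ∷ μ))))

sumOver-lists₃ : ∀ N (f : List ℕ → ℕ) →
  sumOver (listsOfLength N 3) f ≡ ∑[ x < suc N ] ∑[ y < suc N ] ∑[ z < suc N ] f (x ∷ y ∷ z ∷ [])
sumOver-lists₃ N f = trans (sumOver-listsOfLength N 2 f) (sumBelow-cong (suc N) (λ x _ → sumOver-lists₂ N (λ μ → f (x ∷ μ))))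

-- The shape λ = ⟨a, b, c⟩; the two-part case is c = 0 and the one-part case b = c = 0.
-- Every contained μ is ⟨x⟩ ++ t for a tail t, and the admissible tails are ⟨⟩,
-- ⟨y⟩ with 1 ≤ y ≤ b, and ⟨y, z⟩ with 1 ≤ z < y ≤ b, z ≤ c.
module Shape (a b c : ℕ) where

  Tail₁? : ∀ y → Dec (1 ≤ y × y ≤ b)
  Tail₁? y = (1 ≤? y) ×-dec (y ≤? b)

  Tail₂? : ∀ y z → Dec ((1 ≤ z × z < y) × (y ≤ b × z ≤ c))
  Tail₂? y z = ((1 ≤? z) ×-dec (z <? y)) ×-dec ((y ≤? b) ×-dec (z ≤? c))

  FirstPart? : ∀ y s n x → Dec ((y < x × x ≤ a) × x + s ≡ n)
  FirstPart? y s n x = ((y <? x) ×-dec (x ≤? a)) ×-dec (x + s ≟ n)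

  -- The sizes of ⟨x⟩ ++ t, for a tail t with largest part y and sum s, form the interval [y + 1 + s, a + s].
  sizeRange : ℕ → ℕ → ℕ → ℕ
  sizeRange y s n = inInterval (suc y + s) (a + s) n

  firstParts : ∀ y s n → (∑[ x < suc a ] 𝟙 (FirstPart? y s n x)) ≡ sizeRange y s n
  firstParts y s n =
    trans (sumBelow-shift (suc a) s n (λ x → (y <? x) ×-dec (x ≤? a)) (λ x p → s≤s (proj₂ p)))
          (𝟙-cong ((s ≤? n) ×-dec ((y <? (n ∸ s)) ×-dec ((n ∸ s) ≤? a))) ((suc y + s ≤? n) ×-dec (n ≤? a + s))
                  (λ (s≤n , y<x , x≤a) → m≤o∸n⇒m+n≤o (suc y) s≤n y<x , ∸≤⇒≤+ s≤n x≤a)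
                  (λ (lo , hi) → m+n≤o⇒n≤o (suc y) lo , m+n≤o⇒m≤o∸n (suc y) lo , ≤+⇒∸≤ hi))

  -- Sums of a weight w y s over the admissible tails ⟨y⟩, over the tails ⟨y, z⟩, and over all
  -- non-empty admissible tails grouped by their largest part y; s is the sum of the tail.
  pairSum tripleSum tailSum : (ℕ → ℕ → ℕ) → ℕ
  pairSum w = ∑[ y < suc a ] 𝟙 (Tail₁? y) * w y (sum (y ∷ []))
  tripleSum w = ∑[ y < suc a ] ∑[ z < suc a ] 𝟙 (Tail₂? y z) * w y (sum (y ∷ z ∷ []))
  tailSum w = ∑[ y < suc a ] 𝟙 (Tail₁? y) * w y (sum (y ∷ [])) + (∑[ z < suc a ] 𝟙 (Tail₂? y z) * w y (sum (y ∷ z ∷ [])))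

  tailSum-split : ∀ w → tailSum w ≡ pairSum w + tripleSum w
  tailSum-split w = sumBelow-+ (suc a) (λ y → 𝟙 (Tail₁? y) * w y (sum (y ∷ [])))
                                     (λ y → ∑[ z < suc a ] 𝟙 (Tail₂? y z) * w y (sum (y ∷ z ∷ [])))

  -- The closed form of the coefficient of qⁿ: the empty tail contributes [0, a] (x = 0 being μ = ⟨⟩).
  coeff : ℕ → ℕ
  coeff n = inInterval 0 a n + tailSum (λ y s → sizeRange y s n)

  counted₁ : ∀ ls n x → counted (a ∷ ls) n (x ∷ []) ≡ 𝟙 (FirstPart? 0 0 n x)
  counted₁ ls n x = trans (sym (𝟙-× (containedIn? (a ∷ ls) (x ∷ [])) (x + 0 ≟ n)))
    (𝟙-cong (containedIn? (a ∷ ls) (x ∷ []) ×-dec (x + 0 ≟ n)) (FirstPart? 0 0 n x)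
      (λ { (((_ , ap-∷ x≥1 ap-[]) , fu-∷ x≤a fu-[]) , e) → (x≥1 , x≤a) , e })
      (λ { ((x≥1 , x≤a) , e) → ((sd-[x] , ap-∷ x≥1 ap-[]) , fu-∷ x≤a fu-[]) , e }))

  counted₂ : ∀ ls n x y → counted (a ∷ b ∷ ls) n (x ∷ y ∷ []) ≡ 𝟙 (Tail₁? y) * 𝟙 (FirstPart? y (sum (y ∷ [])) n x)
  counted₂ ls n x y = trans (sym (𝟙-× (containedIn? (a ∷ b ∷ ls) (x ∷ y ∷ [])) (x + (y + 0) ≟ n)))
    (trans (𝟙-cong (containedIn? (a ∷ b ∷ ls) (x ∷ y ∷ []) ×-dec (x + (y + 0) ≟ n)) (Tail₁? y ×-dec FirstPart? y (y + 0) n x)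
      (λ { (((sd-∷ y<x sd-[x] , ap-∷ _ (ap-∷ y≥1 ap-[])) , fu-∷ x≤a (fu-∷ y≤b fu-[])) , e) →
             (y≥1 , y≤b) , (y<x , x≤a) , e })
      (λ { ((y≥1 , y≤b) , (y<x , x≤a) , e) →
             ((sd-∷ y<x sd-[x] , ap-∷ (≤-trans y≥1 (<⇒≤ y<x)) (ap-∷ y≥1 ap-[])) , fu-∷ x≤a (fu-∷ y≤b fu-[])) , e }))
    (𝟙-× (Tail₁? y) (FirstPart? y (y + 0) n x)))

  counted₃ : ∀ n x y z → counted (a ∷ b ∷ c ∷ []) n (x ∷ y ∷ z ∷ []) ≡
             𝟙 (Tail₂? y z) * 𝟙 (FirstPart? y (sum (y ∷ z ∷ [])) n x)
  counted₃ n x y z = trans (sym (𝟙-× (containedIn? (a ∷ b ∷ c ∷ []) (x ∷ y ∷ z ∷ [])) (x + s ≟ n)))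
    (trans (𝟙-cong (containedIn? (a ∷ b ∷ c ∷ []) (x ∷ y ∷ z ∷ []) ×-dec (x + s ≟ n)) (Tail₂? y z ×-dec FirstPart? y s n x)
      (λ { (((sd-∷ y<x (sd-∷ z<y sd-[x]) , ap-∷ _ (ap-∷ _ (ap-∷ z≥1 ap-[]))) , fu-∷ x≤a (fu-∷ y≤b (fu-∷ z≤c fu-[]))) , e) →
             ((z≥1 , z<y) , (y≤b , z≤c)) , (y<x , x≤a) , e })
      (λ { (((z≥1 , z<y) , (y≤b , z≤c)) , (y<x , x≤a) , e) →
             let y≥1 = ≤-trans z≥1 (<⇒≤ z<y) in
             ((sd-∷ y<x (sd-∷ z<y sd-[x]) , ap-∷ (≤-trans y≥1 (<⇒≤ y<x)) (ap-∷ y≥1 (ap-∷ z≥1 ap-[]))) ,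
              fu-∷ x≤a (fu-∷ y≤b (fu-∷ z≤c fu-[]))) , e }))
    (𝟙-× (Tail₂? y z) (FirstPart? y s n x)))
    where
    s : ℕ
    s = sum (y ∷ z ∷ [])

  sizes≤1 : ∀ ls n → sumOver (listsUpTo a 1) (counted (a ∷ ls) n) ≡ inInterval 0 a n
  sizes≤1 ls n = begin
      𝟙 (0 ≟ n) + 0 + sumOver (listsOfLength a 1) (counted (a ∷ ls) n)
    ≡⟨ cong₂ _+_ (+-identityʳ _) (sumOver-lists₁ a (counted (a ∷ ls) n)) ⟩
      𝟙 (0 ≟ n) + (∑[ x < suc a ] counted (a ∷ ls) n (x ∷ []))
    ≡⟨ cong (𝟙 (0 ≟ n) +_) (trans (sumBelow-cong (suc a) (λ x _ → counted₁ ls n x)) (firstParts 0 0 n)) ⟩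
      𝟙 (0 ≟ n) + inInterval 1 (a + 0) n
    ≡⟨ cong (λ h → 𝟙 (0 ≟ n) + inInterval 1 h n) (+-identityʳ a) ⟩
      𝟙 (0 ≟ n) + inInterval 1 a n
    ≡⟨ inInterval-split-zero a n ⟩
      inInterval 0 a n
    ∎ where open ≡-Reasoning

  firstParts-weighted : ∀ k y s n → (∑[ x < suc a ] k * 𝟙 (FirstPart? y s n x)) ≡ k * sizeRange y s n
  firstParts-weighted k y s n = trans (sumBelow-*ˡ (suc a) k (λ x → 𝟙 (FirstPart? y s n x))) (cong (k *_) (firstParts y s n))

  sizes₂ : ∀ ls n → sumOver (listsOfLength a 2) (counted (a ∷ b ∷ ls) n) ≡ pairSum (λ y s → sizeRange y s n)
  sizes₂ ls n = begin
      sumOver (listsOfLength a 2) (counted (a ∷ b ∷ ls) n)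
    ≡⟨ sumOver-lists₂ a (counted (a ∷ b ∷ ls) n) ⟩
      (∑[ x < suc a ] ∑[ y < suc a ] counted (a ∷ b ∷ ls) n (x ∷ y ∷ []))
    ≡⟨ sumBelow-cong (suc a) (λ x _ → sumBelow-cong (suc a) (λ y _ → counted₂ ls n x y)) ⟩
      (∑[ x < suc a ] ∑[ y < suc a ] 𝟙 (Tail₁? y) * 𝟙 (FirstPart? y (sum (y ∷ [])) n x))
    ≡⟨ sumBelow-swap (suc a) (suc a) (λ x y → 𝟙 (Tail₁? y) * 𝟙 (FirstPart? y (sum (y ∷ [])) n x)) ⟩
      (∑[ y < suc a ] ∑[ x < suc a ] 𝟙 (Tail₁? y) * 𝟙 (FirstPart? y (sum (y ∷ [])) n x))
    ≡⟨ sumBelow-cong (suc a) (λ y _ → firstParts-weighted (𝟙 (Tail₁? y)) y (sum (y ∷ [])) n) ⟩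
      (∑[ y < suc a ] 𝟙 (Tail₁? y) * sizeRange y (sum (y ∷ [])) n)
    ∎ where open ≡-Reasoning

  sizes₃ : ∀ n → sumOver (listsOfLength a 3) (counted (a ∷ b ∷ c ∷ []) n) ≡ tripleSum (λ y s → sizeRange y s n)
  sizes₃ n = begin
      sumOver (listsOfLength a 3) (counted (a ∷ b ∷ c ∷ []) n)
    ≡⟨ sumOver-lists₃ a (counted (a ∷ b ∷ c ∷ []) n) ⟩
      (∑[ x < suc a ] ∑[ y < suc a ] ∑[ z < suc a ] counted (a ∷ b ∷ c ∷ []) n (x ∷ y ∷ z ∷ []))
    ≡⟨ sumBelow-cong (suc a) (λ x _ → sumBelow-cong (suc a) (λ y _ → sumBelow-cong (suc a) (λ z _ → counted₃ n x y z))) ⟩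
      (∑[ x < suc a ] ∑[ y < suc a ] ∑[ z < suc a ] term x y z)
    ≡⟨ sumBelow-swap (suc a) (suc a) (λ x y → ∑[ z < suc a ] term x y z) ⟩
      (∑[ y < suc a ] ∑[ x < suc a ] ∑[ z < suc a ] term x y z)
    ≡⟨ sumBelow-cong (suc a) (λ y _ → sumBelow-swap (suc a) (suc a) (λ x z → term x y z)) ⟩
      (∑[ y < suc a ] ∑[ z < suc a ] ∑[ x < suc a ] term x y z)
    ≡⟨ sumBelow-cong (suc a) (λ y _ → sumBelow-cong (suc a) (λ z _ →
         firstParts-weighted (𝟙 (Tail₂? y z)) y (sum (y ∷ z ∷ [])) n)) ⟩
      (∑[ y < suc a ] ∑[ z < suc a ] 𝟙 (Tail₂? y z) * sizeRange y (sum (y ∷ z ∷ [])) n)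
    ∎ where
      open ≡-Reasoning
      term : ℕ → ℕ → ℕ → ℕ
      term x y z = 𝟙 (Tail₂? y z) * 𝟙 (FirstPart? y (sum (y ∷ z ∷ [])) n x)

  rank₃ : ∀ n → rankCoeff (a ∷ b ∷ c ∷ []) n ≡ coeff n
  rank₃ n = begin
      rankCoeff (a ∷ b ∷ c ∷ []) n
    ≡⟨ rankCoeff-as-sum (a ∷ b ∷ c ∷ []) n ⟩
      sumOver ((listsUpTo a 1 ++ listsOfLength a 2) ++ listsOfLength a 3) f
    ≡⟨ sumOver-++ (listsUpTo a 1 ++ listsOfLength a 2) (listsOfLength a 3) f ⟩
      sumOver (listsUpTo a 1 ++ listsOfLength a 2) f + sumOver (listsOfLength a 3) f
    ≡⟨ cong (_+ sumOver (listsOfLength a 3) f) (sumOver-++ (listsUpTo a 1) (listsOfLength a 2) f) ⟩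
      sumOver (listsUpTo a 1) f + sumOver (listsOfLength a 2) f + sumOver (listsOfLength a 3) f
    ≡⟨ +-assoc (sumOver (listsUpTo a 1) f) _ _ ⟩
      sumOver (listsUpTo a 1) f + (sumOver (listsOfLength a 2) f + sumOver (listsOfLength a 3) f)
    ≡⟨ cong₂ _+_ (sizes≤1 (b ∷ c ∷ []) n) (cong₂ _+_ (sizes₂ (c ∷ []) n) (sizes₃ n)) ⟩
      inInterval 0 a n + (pairSum w + tripleSum w)
    ≡⟨ cong (inInterval 0 a n +_) (sym (tailSum-split w)) ⟩
      coeff n
    ∎ where
      open ≡-Reasoning
      f : List ℕ → ℕ
      f = counted (a ∷ b ∷ c ∷ []) n
      w : ℕ → ℕ → ℕ
      w y s = sizeRange y s n

  rank₂ : c ≡ 0 → ∀ n → rankCoeff (a ∷ b ∷ []) n ≡ coeff n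
  rank₂ c≡0 n = begin
      rankCoeff (a ∷ b ∷ []) n
    ≡⟨ rankCoeff-as-sum (a ∷ b ∷ []) n ⟩
      sumOver (listsUpTo a 1 ++ listsOfLength a 2) f
    ≡⟨ sumOver-++ (listsUpTo a 1) (listsOfLength a 2) f ⟩
      sumOver (listsUpTo a 1) f + sumOver (listsOfLength a 2) f
    ≡⟨ cong₂ _+_ (sizes≤1 (b ∷ []) n) (sizes₂ [] n) ⟩
      inInterval 0 a n + pairSum w
    ≡⟨ cong (inInterval 0 a n +_) (sym (trans (cong (pairSum w +_) no-triples) (+-identityʳ (pairSum w)))) ⟩
      inInterval 0 a n + (pairSum w + tripleSum w)
    ≡⟨ cong (inInterval 0 a n +_) (sym (tailSum-split w)) ⟩
      coeff n
    ∎ where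
      open ≡-Reasoning
      f : List ℕ → ℕ
      f = counted (a ∷ b ∷ []) n
      w : ℕ → ℕ → ℕ
      w y s = sizeRange y s n
      no-triples : tripleSum w ≡ 0
      no-triples = sumBelow-zero (suc a) (λ y _ → sumBelow-zero (suc a) (λ z _ →
        cong (_* w y (sum (y ∷ z ∷ [])))
          (𝟙-no (Tail₂? y z) (λ ((z≥1 , _) , (_ , z≤c)) → <⇒≱ z≥1 (subst (z ≤_) c≡0 z≤c)))))

  rank₁ : ∀ n → rankCoeff (a ∷ []) n ≡ inInterval 0 a n
  rank₁ n = trans (rankCoeff-as-sum (a ∷ []) n) (sizes≤1 [] n)

  tailSum-balance : (w₁ w₂ w₃ w₄ : ℕ → ℕ → ℕ) → (∀ y s → y < suc a → w₁ y s + w₂ y s ≡ w₃ y s + w₄ y s) →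
                    tailSum w₁ + tailSum w₂ ≡ tailSum w₃ + tailSum w₄
  tailSum-balance w₁ w₂ w₃ w₄ e = sumBelow-balance (suc a) (summand w₁) (summand w₂) (summand w₃) (summand w₄) per-top
    where
    weighted : (ℕ → ℕ → ℕ) → ℕ → ℕ → ℕ → ℕ
    weighted w k y s = k * w y s
    pair : (ℕ → ℕ → ℕ) → ℕ → ℕ
    pair w y = weighted w (𝟙 (Tail₁? y)) y (sum (y ∷ []))
    triples : (ℕ → ℕ → ℕ) → ℕ → ℕ → ℕ
    triples w y z = weighted w (𝟙 (Tail₂? y z)) y (sum (y ∷ z ∷ []))
    summand : (ℕ → ℕ → ℕ) → ℕ → ℕ
    summand w y = pair w y + sumBelow (suc a) (triples w y)
    scaled : ∀ k y s → y < suc a → weighted w₁ k y s + weighted w₂ k y s ≡ weighted w₃ k y s + weighted w₄ k y s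
    scaled k y s y≤a = *-balance k (e y s y≤a)
    per-top : ∀ y → y < suc a → summand w₁ y + summand w₂ y ≡ summand w₃ y + summand w₄ y
    per-top y y≤a = +-balance (pair w₁ y) (pair w₂ y) (pair w₃ y) (pair w₄ y)
      (sumBelow (suc a) (triples w₁ y)) (sumBelow (suc a) (triples w₂ y))
      (sumBelow (suc a) (triples w₃ y)) (sumBelow (suc a) (triples w₄ y))
      (scaled (𝟙 (Tail₁? y)) y (sum (y ∷ [])) y≤a)
      (sumBelow-balance (suc a) (triples w₁ y) (triples w₂ y) (triples w₃ y) (triples w₄ y)
                        (λ z _ → scaled (𝟙 (Tail₂? y z)) y (sum (y ∷ z ∷ [])) y≤a))

  -- A tail ⟨y⟩ or ⟨y, z⟩ with largest part y has sum y + r with r ∈ {0} ∪ [1, min(y − 1, c)];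
  -- Window y s n says that n = s + r for such an r (and y ≤ b).
  Window? : ∀ y s n → Dec (y ≤ b × (s ≤ n × (n < y + s × n ≤ c + s)))
  Window? y s n = (y ≤? b) ×-dec ((s ≤? n) ×-dec ((n <? y + s) ×-dec (n ≤? c + s)))

  tailsWithTop : ∀ t y n → y < suc a →
    𝟙 (Tail₁? y) * 𝟙 (t + sum (y ∷ []) ≟ n) + (∑[ z < suc a ] 𝟙 (Tail₂? y z) * 𝟙 (t + sum (y ∷ z ∷ []) ≟ n))
      ≡ 𝟙 (Window? y (t + y) n)
  tailsWithTop t y n y≤a = trans (cong₂ _+_ pairs triples)
    (𝟙-disjoint-union (Tail₁? y ×-dec (s ≟ n)) ((s ≤? n) ×-dec Tail₂? y (n ∸ s)) (Window? y s n)
      split from-pair from-triple disjoint)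
    where
    s : ℕ
    s = t + y
    pairs : 𝟙 (Tail₁? y) * 𝟙 (t + (y + 0) ≟ n) ≡ 𝟙 (Tail₁? y ×-dec (s ≟ n))
    pairs = trans (cong (λ u → 𝟙 (Tail₁? y) * 𝟙 (t + u ≟ n)) (+-identityʳ y)) (sym (𝟙-× (Tail₁? y) (s ≟ n)))
    reorder : ∀ z → t + (y + (z + 0)) ≡ z + (t + y)
    reorder z = trans (cong (λ u → t + (y + u)) (+-identityʳ z)) (trans (sym (+-assoc t y z)) (+-comm (t + y) z))
    triples : (∑[ z < suc a ] 𝟙 (Tail₂? y z) * 𝟙 (t + (y + (z + 0)) ≟ n)) ≡ 𝟙 ((s ≤? n) ×-dec Tail₂? y (n ∸ s))
    triples = trans (sumBelow-cong (suc a) (λ z _ →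
                       trans (cong (λ u → 𝟙 (Tail₂? y z) * 𝟙 (u ≟ n)) (reorder z)) (sym (𝟙-× (Tail₂? y z) (z + s ≟ n)))))
                    (sumBelow-shift (suc a) s n (Tail₂? y) (λ z ((_ , z<y) , _) → <-trans z<y y≤a))
    InWindow PairHit TripleHit : Set
    InWindow = y ≤ b × (s ≤ n × (n < y + s × n ≤ c + s))
    PairHit = (1 ≤ y × y ≤ b) × s ≡ n
    TripleHit = s ≤ n × ((1 ≤ n ∸ s × n ∸ s < y) × (y ≤ b × n ∸ s ≤ c))
    split : InWindow → PairHit ⊎ TripleHit
    split (y≤b , s≤n , n<y+s , n≤c+s) with s ≟ n
    ... | yes refl = inj₁ ((subst (1 ≤_) (m+n∸n≡m y s) (m<n⇒0<n∸m n<y+s) , y≤b) , refl)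
    ... | no s≢n = inj₂ (s≤n , ((m+n≤o⇒m≤o∸n 1 (≤∧≢⇒< s≤n s≢n) , <+⇒∸< s≤n n<y+s) , (y≤b , ≤+⇒∸≤ n≤c+s)))
    from-pair : PairHit → InWindow
    from-pair ((y≥1 , y≤b) , refl) = y≤b , ≤-refl , m<n+m s y≥1 , m≤n+m s c
    from-triple : TripleHit → InWindow
    from-triple (s≤n , (_ , r<y) , (y≤b , r≤c)) = y≤b , s≤n , ∸<⇒<+ s≤n r<y , ∸≤⇒≤+ s≤n r≤c
    disjoint : PairHit → TripleHit → ⊥
    disjoint (_ , refl) (_ , (r≥1 , _) , _) = <⇒≱ r≥1 (≤-reflexive (n∸n≡0 s))

  -- entering n counts the tails whose size interval starts at n + 1, leaving n those whose
  -- interval ends at n (the empty tail's interval [0, a] included).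
  entering leaving : ℕ → ℕ
  entering n = ∑[ y < suc a ] 𝟙 (Window? y (y + y) n)
  leaving n = 𝟙 (a ≟ n) + (∑[ y < suc a ] 𝟙 (Window? y (a + y) n))

  coeff-balance : ∀ n → coeff (suc n) + leaving n ≡ coeff n + entering n
  coeff-balance n = begin
      coeff (suc n) + leaving n
    ≡⟨ cong (λ v → coeff (suc n) + (𝟙 (a ≟ n) + v)) (sym (tailsByTop (λ _ → a))) ⟩
      coeff (suc n) + (𝟙 (a ≟ n) + tailSum (λ y s → 𝟙 (a + s ≟ n)))
    ≡⟨ +-balance (inInterval 0 a (suc n)) (𝟙 (a ≟ n)) (inInterval 0 a n) 0
                 (tailSum (sizesAt (suc n))) (tailSum ends) (tailSum (sizesAt n)) (tailSum starts)
                 (inInterval-step 0 a n z≤n)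
                 (tailSum-balance (sizesAt (suc n)) ends (sizesAt n) starts
                    (λ y s y≤a → inInterval-step (suc y + s) (a + s) n (s≤s (+-monoˡ-≤ s (s≤s⁻¹ y≤a))))) ⟩
      coeff n + tailSum (λ y s → 𝟙 (y + s ≟ n))
    ≡⟨ cong (coeff n +_) (tailsByTop (λ y → y)) ⟩
      coeff n + entering n
    ∎ where
      open ≡-Reasoning
      sizesAt : ℕ → ℕ → ℕ → ℕ
      sizesAt m y s = sizeRange y s m
      ends starts : ℕ → ℕ → ℕ
      ends y s = 𝟙 (a + s ≟ n)
      starts y s = 𝟙 (y + s ≟ n)
      tailsByTop : (t : ℕ → ℕ) → tailSum (λ y s → 𝟙 (t y + s ≟ n)) ≡ ∑[ y < suc a ] 𝟙 (Window? y (t y + y) n)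
      tailsByTop t = sumBelow-cong (suc a) (λ y y≤a → tailsWithTop (t y) y n y≤a)

  -- The window condition only depends on n − s, so it is invariant under translating s and n.
  window-shift : ∀ y t s n → 𝟙 (Window? y (t + s) (t + n)) ≡ 𝟙 (Window? y s n)
  window-shift y t s n = 𝟙-cong (Window? y (t + s) (t + n)) (Window? y s n)
    (λ (y≤b , s≤n , n<y+s , n≤c+s) → y≤b , +-cancelˡ-≤ t s n s≤n ,
       +-cancelˡ-< t n (y + s) (subst (t + n <_) (shuffle y) n<y+s) ,
       +-cancelˡ-≤ t n (c + s) (subst (t + n ≤_) (shuffle c) n≤c+s))
    (λ (y≤b , s≤n , n<y+s , n≤c+s) → y≤b , +-monoʳ-≤ t s≤n ,
       subst (t + n <_) (sym (shuffle y)) (+-monoʳ-< t n<y+s) ,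
       subst (t + n ≤_) (sym (shuffle c)) (+-monoʳ-≤ t n≤c+s))
    where
    shuffle : ∀ u → u + (t + s) ≡ t + (u + s)
    shuffle u = trans (sym (+-assoc u t s)) (trans (cong (_+ s) (+-comm u t)) (+-assoc t u s))

  -- For a strictly decreasing λ = ⟨a, b, c⟩ (a > b > c, where c = 0 is allowed) the
  -- difference entering − leaving changes sign at most once.
  module Crossing (b<a : b < a) (c<b : c < b) where

    y≤b⇒y<1+a : ∀ {y} → y ≤ b → y < suc a
    y≤b⇒y<1+a y≤b = s≤s (≤-trans y≤b (<⇒≤ b<a))

    -- Every size interval ends at a + (tail sum) ≥ a.
    leaving-below-a : ∀ k → k < a → leaving k ≡ 0
    leaving-below-a k k<a = cong₂ _+_ (𝟙-no (a ≟ k) (λ e → <-irrefl (sym e) k<a))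
      (sumBelow-zero (suc a) (λ y _ → 𝟙-no (Window? y (a + y) k) (λ (_ , a+y≤k , _) → <⇒≱ k<a (≤-trans (m≤m+n a y) a+y≤k))))

    -- Past a + b, every tail counted as entering is also counted as leaving.
    entering≤leaving-beyond : ∀ k → a + b < k → entering k ≤ leaving k
    entering≤leaving-beyond k a+b<k =
      ≤-trans (sumBelow-mono (suc a) (λ y _ → 𝟙-mono (Window? y (y + y) k) (Window? y (a + y) k) (also-leaving y)))
              (m≤n+m _ (𝟙 (a ≟ k)))
      where
      also-leaving : ∀ y → y ≤ b × (y + y ≤ k × (k < y + (y + y) × k ≤ c + (y + y))) →
                     y ≤ b × (a + y ≤ k × (k < y + (a + y) × k ≤ c + (a + y)))
      also-leaving y (y≤b , _ , k<3y , k≤c+2y) =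
        let y≤a = ≤-trans y≤b (<⇒≤ b<a) in
        y≤b , ≤-trans (+-monoʳ-≤ a y≤b) (<⇒≤ a+b<k) ,
        <-≤-trans k<3y (+-monoʳ-≤ y (+-monoˡ-≤ y y≤a)) , ≤-trans k≤c+2y (+-monoʳ-≤ c (+-monoˡ-≤ y y≤a))

    leaving-shifted : ∀ j → leaving (a + j) ≡ 𝟙 (a ≟ a + j) + (∑[ y < suc a ] 𝟙 (Window? y y j))
    leaving-shifted j = cong (𝟙 (a ≟ a + j) +_) (sumBelow-cong (suc a) (λ y _ → window-shift y a y j))

    -- The entering tails at k have top part y ∈ [⌈(k ∸ c)/2⌉, ⌊k/2⌋], so at most (c + 2)/2 of them.
    entering-bounded : ∀ k → entering k + entering k ≤ c + 2
    entering-bounded k = ≤-trans (+-mono-≤ entering≤ entering≤) (double-∸ (suc h) g (c + 2) doubled)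
      where
      h g : ℕ
      h = ⌊ k /2⌋
      g = ⌈ (k ∸ c) /2⌉
      entering≤ : entering k ≤ suc h ∸ g
      entering≤ = ≤-trans
        (sumBelow-mono (suc a) (λ y _ → 𝟙-mono (Window? y (y + y) k) ((g ≤? y) ×-dec (y ≤? h))
          (λ (_ , 2y≤k , _ , k≤c+2y) → ≤double⇒⌈/2⌉≤ (m≤n+o⇒m∸n≤o k c k≤c+2y) , double≤⇒≤⌊/2⌋ 2y≤k)))
        (countBetween≤ (suc a) g h)
      h+h≤c+g+g : h + h ≤ c + (g + g)
      h+h≤c+g+g = ≤-trans (⌊n/2⌋-double≤n k) (≤-trans (m≤n+m∸n k c) (+-monoʳ-≤ c (n≤⌈n/2⌉-double (k ∸ c))))
      doubled : suc h + suc h ≤ (c + 2) + (g + g)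
      doubled = subst₂ _≤_ (sym (double-suc h)) (cong (_+ (g + g)) (+-comm 2 c)) (s≤s (s≤s h+h≤c+g+g))

    -- Over t more steps the entering count grows by at most (t + 1)/2: a tail entering at k + t
    -- but not at k has its top part in (⌊k/2⌋, ⌊(k + t)/2⌋].
    entering-slow : ∀ k t → entering (k + t) + entering (k + t) ≤ (entering k + entering k) + suc t
    entering-slow k t = ≤-trans (+-mono-≤ grows-by-w grows-by-w)
      (subst (_≤ (E + E) + suc t) (sym (+-interchange E w E w)) (+-monoʳ-≤ (E + E) (double-∸ H h (suc t) doubled)))
      where
      E h H w : ℕ
      E = entering k
      h = ⌊ k /2⌋
      H = ⌊ (k + t) /2⌋
      w = H ∸ h
      old-or-new : ∀ y → y ≤ b × (y + y ≤ k + t × (k + t < y + (y + y) × k + t ≤ c + (y + y))) →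
                   y ≤ b × (y + y ≤ k × (k < y + (y + y) × k ≤ c + (y + y))) ⊎ (suc h ≤ y × y ≤ H)
      old-or-new y (y≤b , 2y≤k+t , k+t<3y , k+t≤c+2y) with y + y ≤? k
      ... | yes 2y≤k = inj₁ (y≤b , 2y≤k , ≤-<-trans (m≤m+n k t) k+t<3y , ≤-trans (m≤m+n k t) k+t≤c+2y)
      ... | no 2y≰k = inj₂ (<double⇒⌊/2⌋< (≰⇒> 2y≰k) , double≤⇒≤⌊/2⌋ 2y≤k+t)
      grows-by-w : entering (k + t) ≤ E + w
      grows-by-w = ≤-trans
        (sumBelow-mono (suc a) (λ y _ →
          𝟙-cover (Window? y (y + y) k) ((suc h ≤? y) ×-dec (y ≤? H)) (Window? y (y + y) (k + t)) (old-or-new y)))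
        (subst (_≤ E + w) (sym (sumBelow-+ (suc a) (λ y → 𝟙 (Window? y (y + y) k)) (λ y → 𝟙 ((suc h ≤? y) ×-dec (y ≤? H)))))
               (+-monoʳ-≤ E (countBetween≤ (suc a) (suc h) H)))
      doubled : H + H ≤ suc t + (h + h)
      doubled = ≤-trans (⌊n/2⌋-double≤n (k + t))
                  (≤-trans (+-monoˡ-≤ t (n≤1+⌊n/2⌋-double k)) (≤-reflexive (cong suc (+-comm (h + h) t))))

    -- For j ≤ c, the tails leaving at a + j are those with top part y ∈ (⌊j/2⌋, j].
    leaving-small : ∀ j → j ≤ c → leaving (a + j) ≡ 𝟙 (a ≟ a + j) + ⌈ j /2⌉
    leaving-small j j≤c = trans (leaving-shifted j) (cong (𝟙 (a ≟ a + j) +_) (begin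
        (∑[ y < suc a ] 𝟙 (Window? y y j))
      ≡⟨ sumBelow-cong (suc a) (λ y _ → 𝟙-cong (Window? y y j) ((suc ⌊ j /2⌋ ≤? y) ×-dec (y ≤? j)) to from) ⟩
        countBetween (suc a) (suc ⌊ j /2⌋) j
      ≡⟨ countBetween≡ (suc a) (suc ⌊ j /2⌋) j (y≤b⇒y<1+a j≤b) ⟩
        j ∸ ⌊ j /2⌋
      ≡⟨ cong (_∸ ⌊ j /2⌋) (sym (⌊n/2⌋+⌈n/2⌉≡n j)) ⟩
        (⌊ j /2⌋ + ⌈ j /2⌉) ∸ ⌊ j /2⌋
      ≡⟨ m+n∸m≡n ⌊ j /2⌋ ⌈ j /2⌉ ⟩
        ⌈ j /2⌉
      ∎))
      where
      open ≡-Reasoning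
      j≤b : j ≤ b
      j≤b = ≤-trans j≤c (<⇒≤ c<b)
      to : ∀ {y} → y ≤ b × (y ≤ j × (j < y + y × j ≤ c + y)) → suc ⌊ j /2⌋ ≤ y × y ≤ j
      to (_ , y≤j , j<2y , _) = <double⇒⌊/2⌋< j<2y , y≤j
      from : ∀ {y} → suc ⌊ j /2⌋ ≤ y × y ≤ j → y ≤ b × (y ≤ j × (j < y + y × j ≤ c + y))
      from {y} (⌊j/2⌋<y , y≤j) = ≤-trans y≤j j≤b , y≤j , ⌊/2⌋<⇒<double ⌊j/2⌋<y , ≤-trans j≤c (m≤m+n c y)

    leaving-small-upper : ∀ j → j ≤ c → leaving (a + j) + leaving (a + j) ≤ j + 2
    leaving-small-upper zero j≤c rewrite leaving-small zero j≤c =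
      +-mono-≤ (+-monoˡ-≤ 0 (𝟙≤1 (a ≟ a + 0))) (+-monoˡ-≤ 0 (𝟙≤1 (a ≟ a + 0)))
    leaving-small-upper (suc j) j≤c
      rewrite leaving-small (suc j) j≤c | 𝟙-no (a ≟ a + suc j) (λ e → m≢1+m+n a (trans e (+-suc a j))) =
      ≤-trans (⌊n/2⌋-double≤n (suc (suc j))) (≤-trans (n≤1+n _) (≤-reflexive (+-comm 2 (suc j))))

    leaving-small-lower : ∀ j → j ≤ c → j ≤ leaving (a + j) + leaving (a + j)
    leaving-small-lower j j≤c rewrite leaving-small j j≤c =
      ≤-trans (n≤⌈n/2⌉-double j) (+-mono-≤ (m≤n+m ⌈ j /2⌉ (𝟙 (a ≟ a + j))) (m≤n+m ⌈ j /2⌉ (𝟙 (a ≟ a + j))))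

    -- For c < j ≤ b, all tails with top part y ∈ [j ∸ ⌊c/2⌋, j] leave at a + j.
    leaving-large : ∀ j → c < j → j ≤ b → suc c ≤ leaving (a + j) + leaving (a + j)
    leaving-large j c<j j≤b = ≤-trans c<double (+-mono-≤ count≤leaving count≤leaving)
      where
      g L : ℕ
      g = ⌊ c /2⌋
      L = j ∸ g
      g+g≤c : g + g ≤ c
      g+g≤c = ⌊n/2⌋-double≤n c
      g≤j : g ≤ j
      g≤j = ≤-trans (≤-trans (m≤m+n g g) g+g≤c) (<⇒≤ c<j)
      g<L : g < L
      g<L = m+n≤o⇒m≤o∸n (suc g) (≤-trans (s≤s g+g≤c) c<j)
      leaves : ∀ {y} → L ≤ y × y ≤ j → y ≤ b × (y ≤ j × (j < y + y × j ≤ c + y))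
      leaves {y} (L≤y , y≤j) = ≤-trans y≤j j≤b , y≤j ,
        subst (_< y + y) (m∸n+n≡m g≤j) (<-≤-trans (+-monoʳ-< L g<L) (+-mono-≤ L≤y L≤y)) ,
        subst (_≤ c + y) (m∸n+n≡m g≤j) (subst (L + g ≤_) (+-comm y c) (+-mono-≤ L≤y (≤-trans (m≤m+n g g) g+g≤c)))
      count≤leaving : suc g ≤ leaving (a + j)
      count≤leaving = begin
          suc g
        ≡⟨ cong suc (sym (m∸[m∸n]≡n g≤j)) ⟩
          suc (j ∸ L)
        ≡⟨ sym (+-∸-assoc 1 (m∸n≤m j g)) ⟩
          suc j ∸ L
        ≡⟨ sym (countBetween≡ (suc a) L j (y≤b⇒y<1+a j≤b)) ⟩
          countBetween (suc a) L j
        ≤⟨ sumBelow-mono (suc a) (λ y _ → 𝟙-mono ((L ≤? y) ×-dec (y ≤? j)) (Window? y y j) leaves) ⟩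
          (∑[ y < suc a ] 𝟙 (Window? y y j))
        ≤⟨ m≤n+m _ (𝟙 (a ≟ a + j)) ⟩
          𝟙 (a ≟ a + j) + (∑[ y < suc a ] 𝟙 (Window? y y j))
        ≡⟨ sym (leaving-shifted j) ⟩
          leaving (a + j)
        ∎ where open ≤-Reasoning
      c<double : suc c ≤ suc g + suc g
      c<double = subst (suc c ≤_) (sym (double-suc g)) (s≤s (n≤1+⌊n/2⌋-double c))

    -- Below a + b, a crossing at a + j persists: for j + t > c the entering count is at most
    -- (c + 2)/2 while the leaving count is at least (c + 1)/2; for j + t ≤ c the entering count
    -- starts at most j/2 and grows by at most (t + 1)/2, while the leaving count is at least (j + t)/2.
    crossing-within : ∀ j t → j + t ≤ b → entering (a + j) < leaving (a + j) →
                      entering (a + j + t) ≤ leaving (a + j + t)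
    crossing-within j t j+t≤b E<L with c <? j + t
    ... | yes c<j+t = double≤1+double⇒≤ (begin
          E' + E'
        ≤⟨ entering-bounded (a + j + t) ⟩
          c + 2
        ≡⟨ +-comm c 2 ⟩
          suc (suc c)
        ≤⟨ s≤s (subst (λ k → suc c ≤ leaving k + leaving k) (sym (+-assoc a j t)) (leaving-large (j + t) c<j+t j+t≤b)) ⟩
          suc (L' + L')
        ∎)
      where
      open ≤-Reasoning
      E' L' : ℕ
      E' = entering (a + j + t)
      L' = leaving (a + j + t)
    ... | no c≮j+t = double≤1+double⇒≤ (begin
          E' + E'
        ≤⟨ entering-slow (a + j) t ⟩
          (E + E) + suc t
        ≤⟨ +-monoˡ-≤ (suc t) E+E≤j ⟩
          j + suc t
        ≡⟨ +-suc j t ⟩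
          suc (j + t)
        ≤⟨ s≤s (subst (λ k → j + t ≤ leaving k + leaving k) (sym (+-assoc a j t)) (leaving-small-lower (j + t) j+t≤c)) ⟩
          suc (L' + L')
        ∎)
      where
      open ≤-Reasoning
      E E' L' : ℕ
      E = entering (a + j)
      E' = entering (a + j + t)
      L' = leaving (a + j + t)
      j+t≤c : j + t ≤ c
      j+t≤c = ≮⇒≥ c≮j+t
      E+E≤j : E + E ≤ j
      E+E≤j = s≤s⁻¹ (s≤s⁻¹ (subst₂ _≤_ (double-suc E) (+-comm j 2)
                (≤-trans (+-mono-≤ E<L E<L) (leaving-small-upper j (≤-trans (m≤m+n j t) j+t≤c)))))

    single-crossing : ∀ k k' → k ≤ k' → entering k < leaving k → entering k' ≤ leaving k'
    single-crossing k k' k≤k' E<L with k <? a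
    ... | yes k<a = ⊥-elim (<⇒≱ E<L (subst (_≤ entering k) (sym (leaving-below-a k k<a)) z≤n))
    ... | no k≮a with a + b <? k'
    ...   | yes beyond = entering≤leaving-beyond k' beyond
    ...   | no ¬beyond = subst (λ x → entering x ≤ leaving x) k'≡
                           (crossing-within j t j+t≤b (subst (λ x → entering x < leaving x) (sym k≡) E<L))
      where
      j t : ℕ
      j = k ∸ a
      t = k' ∸ k
      k≡ : a + j ≡ k
      k≡ = m+[n∸m]≡n (≮⇒≥ k≮a)
      k'≡ : a + j + t ≡ k'
      k'≡ = trans (cong (_+ t) k≡) (m+[n∸m]≡n k≤k')
      j+t≤b : j + t ≤ b
      j+t≤b = +-cancelˡ-≤ a (j + t) b (subst (_≤ a + b) (trans (sym k'≡) (+-assoc a j t)) (≮⇒≥ ¬beyond))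

    unimodal : Unimodal coeff
    unimodal = unimodal-by-balance coeff entering leaving coeff-balance single-crossing (suc (a + b)) entering≤leaving-beyond

theorem3p6 : (λ' : List ℕ) → DistinctPartition λ' → length λ' ≤ 3 → Unimodal (rankCoeff λ')
theorem3p6 [] _ _ = 0 , (λ i ()) , (λ i _ → z≤n)
theorem3p6 (a ∷ []) _ _ = Unimodal-≗ (Shape.rank₁ a 0 0) (interval-unimodal a)
theorem3p6 (a ∷ b ∷ []) (sd-∷ b<a sd-[x] , ap-∷ _ (ap-∷ b≥1 ap-[])) _ =
  Unimodal-≗ (Shape.rank₂ a b 0 refl) (Shape.Crossing.unimodal a b 0 b<a b≥1)
theorem3p6 (a ∷ b ∷ c ∷ []) (sd-∷ b<a (sd-∷ c<b sd-[x]) , _) _ =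
  Unimodal-≗ (Shape.rank₃ a b c) (Shape.Crossing.unimodal a b c b<a c<b)
theorem3p6 (_ ∷ _ ∷ _ ∷ _ ∷ _) _ (s≤s (s≤s (s≤s ())))
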